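{- Let $\mathsf{T}$ be a rooted plane tree, and let $(\lambda_1,\varrho_1)\lessdot(\lambda_2,\varrho_2)$ be a cover relation in $\Theta(\mathsf{T}^\times)$. If $(\lambda_1,\varrho_1)$ and $(\lambda_2,\varrho_2)$ are related by an associahedron move, then the set $\Delta(\lambda_2,\varrho_2)\setminus\Delta(\lambda_1,\varrho_1)$ has a unique minimal element.
   Context: A rooted plane tree $\mathsf{T}$ with $n+1$ vertices is viewed as a poset $\leq_\mathsf{T}$ on its vertices with the root as unique minimum and each non-root vertex covering exactly its parent; vertices are identified with $\{0,\ldots,n\}$ so that $0,1,\ldots,n$ is the preorder traversal (root first, then the subtrees of the root, each recursively in preorder, left to right). $\mathsf{T}^\times$ is the forest poset on $[n]$ obtained by deleting the root $0$. An ornament is a subset of $[n]$ inducing a connected subgraph of $\mathsf{T}^\times$, hung at its minimal element; an ornamentation is a function $\varrho$ from $[n]$ to ornaments with $\varrho(v)$ hung at $v$ and any two values nested or disjoint; ornamentations are ordered by pointwise containment. $\mathcal L(\mathsf{T}^\times)$ is the set of permutations $\lambda$ of $[n]$ (one-line notation) such that $x<_\mathsf{T}y$ implies $x$ precedes $y$, ordered by the weak order (containment of inversion sets; an inversion is a pair $(i,j)$, $i<j$, with $j$ before $i$). $\Theta(\mathsf{T}^\times)$ is the set of pairs $(\lambda,\varrho)$ ($\lambda\in\mathcal L(\mathsf{T}^\times)$, $\varrho$ an ornamentation) such that each $\varrho(v)$ occupies consecutive positions of $\lambda$, ordered by $(\lambda,\varrho)\leq(\lambda',\varrho')$ iff $\lambda\leq\lambda'$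 and $\varrho\leq\varrho'$. For $x\in\Theta(\mathsf{T}^\times)$, $\nabla(x)=\{z: x\leq z\}$ and $\Delta(x)=\{z:z\leq x\}$. A cover relation $(\lambda_1,\varrho_1)\lessdot(\lambda_2,\varrho_2)$ is related by an associahedron move if $\lambda_1=\lambda_2$ and there is $t\in[n]$ with $\varrho_1(v)=\varrho_2(v)$ for all $v\neq t$ and $\varrho_2(t)=\varrho_1(t)\cup\varrho_1(t^\to)$, where $t^\to$ is the entry of $\lambda_1$ immediately after the block of entries of $\varrho_1(t)$. -}

module Defs where

open import Data.Nat as ℕ using (ℕ; zero; suc; _+_)
open import Data.Fin as Fin using (Fin; toℕ)
open import Data.Fin.Subset using (Subset; _∈_; _∉_; _⊆_; _∪_)
open import Data.Vec using (Vec; lookup)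
open import Data.List using (List; []; _∷_)
open import Data.Product using (Σ; ∃; ∃-syntax; _×_; _,_)
open import Data.Sum using (_⊎_)
open import Relation.Nullary using (¬_)
open import Relation.Binary.PropositionalEquality using (_≡_; _≢_)

data PTree : Set where
  node : List PTree → PTree

children : PTree → List PTree
children (node ts) = ts

mutual
  size : PTree → ℕ
  size (node ts) = suc (fsize ts)

  fsize : List PTree → ℕ
  fsize []       = 0
  fsize (t ∷ ts) = size t + fsize ts

-- The tree order with vertices labelled by preorder traversal.
-- Anc t u v   : u ≤_t v   in the tree t, labels 0 .. size t - 1 (root 0).
-- AncF F u v  : u ≤ v     in the forest F (trees left to right, each in
--                          preorder), labels 0 .. fsize F - 1.

mutual
  data Anc : PTree → ℕ → ℕ → Set where
    root : ∀ {ts v} → v ℕ.< size (node ts) → Anc (node ts) 0 v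
    down : ∀ {ts u v} → AncF ts u v → Anc (node ts) (suc u) (suc v)

  data AncF : List PTree → ℕ → ℕ → Set where
    here  : ∀ {c cs u v} → Anc c u v → AncF (c ∷ cs) u v
    there : ∀ {c cs u v} → AncF cs u v →
            AncF (c ∷ cs) (size c + u) (size c + v)

-- T^× is the forest  children T  on n = fsize (children T)
-- vertices.  Vertex k ∈ [n] of the paper is represented by the element
-- of Fin n with toℕ = k - 1 (an order-preserving relabelling, so the
-- weak order / inversions are unaffected).

module _ (T : PTree) where

  private
    F = children T
  N : ℕ
  N = fsize F

  _≤T_ : Fin N → Fin N → Set
  x ≤T y = AncF F (toℕ x) (toℕ y)

  _<T_ : Fin N → Fin N → Set
  x <T y = x ≤T y × x ≢ y

  _⋖T_ : Fin N → Fin N → Set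
  x ⋖T y = x <T y × (∀ z → x ≤T z → z ≤T y → z ≡ x ⊎ z ≡ y)

  Adjacent : Fin N → Fin N → Set
  Adjacent a b = a ⋖T b ⊎ b ⋖T a

  data Walk (S : Subset N) : Fin N → Fin N → Set where
    stop : ∀ {a} → a ∈ S → Walk S a a
    step : ∀ {a c b} → a ∈ S → Adjacent a c → Walk S c b → Walk S a b

  Connected : Subset N → Set
  Connected S = ∀ a b → a ∈ S → b ∈ S → Walk S a b

  OrnamentAt : Fin N → Subset N → Set
  OrnamentAt v S = Connected S × v ∈ S × (∀ w → w ∈ S → v ≤T w)

  Disjoint : Subset N → Subset N → Set
  Disjoint A B = ∀ x → ¬ (x ∈ A × x ∈ B)

  Ornamentation : Vec (Subset N) N → Set
  Ornamentation ρ =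
    (∀ v → OrnamentAt v (lookup ρ v)) ×
    (∀ v w → lookup ρ v ⊆ lookup ρ w ⊎ lookup ρ w ⊆ lookup ρ v
             ⊎ Disjoint (lookup ρ v) (lookup ρ w))

  -- permutations in one-line notation: lookup λ i = entry at position i
  IsPerm : Vec (Fin N) N → Set
  IsPerm λ′ = ∀ i j → lookup λ′ i ≡ lookup λ′ j → i ≡ j

  Precedes : Vec (Fin N) N → Fin N → Fin N → Set
  Precedes λ′ x y = ∃[ i ] ∃[ j ] (i Fin.< j × lookup λ′ i ≡ x × lookup λ′ j ≡ y)

  LinExt : Vec (Fin N) N → Set
  LinExt λ′ = IsPerm λ′ × (∀ x y → x <T y → Precedes λ′ x y)

  WeakLeq : Vec (Fin N) N → Vec (Fin N) N → Set
  WeakLeq λ₁ λ₂ = ∀ a b → a Fin.< b → Precedes λ₁ b a → Precedes λ₂ b a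

  OrnLeq : Vec (Subset N) N → Vec (Subset N) N → Set
  OrnLeq ρ₁ ρ₂ = ∀ v → lookup ρ₁ v ⊆ lookup ρ₂ v

  Consecutive : Vec (Fin N) N → Subset N → Set
  Consecutive λ′ S = ∀ i j k → i Fin.≤ j → j Fin.≤ k →
    lookup λ′ i ∈ S → lookup λ′ k ∈ S → lookup λ′ j ∈ S

  Pair : Set
  Pair = Vec (Fin N) N × Vec (Subset N) N

  InTheta : Pair → Set
  InTheta (λ′ , ρ) = LinExt λ′ × Ornamentation ρ × (∀ v → Consecutive λ′ (lookup ρ v))

  _≤Θ_ : Pair → Pair → Set
  (λ₁ , ρ₁) ≤Θ (λ₂ , ρ₂) = WeakLeq λ₁ λ₂ × OrnLeq ρ₁ ρ₂

  _⋖Θ_ : Pair → Pair → Set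
  x ⋖Θ y = x ≤Θ y × x ≢ y ×
    (∀ z → InTheta z → x ≤Θ z → z ≤Θ y → z ≡ x ⊎ z ≡ y)

  AfterBlock : Vec (Fin N) N → Subset N → Fin N → Set
  AfterBlock λ′ S u = ∃[ i ] ∃[ i′ ]
    (lookup λ′ i ∈ S × (∀ k → lookup λ′ k ∈ S → k Fin.≤ i) ×
     toℕ i′ ≡ suc (toℕ i) × lookup λ′ i′ ≡ u)

  AssocMove : Pair → Pair → Set
  AssocMove (λ₁ , ρ₁) (λ₂ , ρ₂) = λ₁ ≡ λ₂ × ∃[ t ] ∃[ u ]
    (AfterBlock λ₁ (lookup ρ₁ t) u ×
     (∀ v → v ≢ t → lookup ρ₁ v ≡ lookup ρ₂ v) ×
     lookup ρ₂ t ≡ lookup ρ₁ t ∪ lookup ρ₁ u)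

  InΔ : Pair → Pair → Set
  InΔ x z = InTheta z × z ≤Θ x

  MinimalIn : (Pair → Set) → Pair → Set
  MinimalIn D m = D m × (∀ z → D z → z ≤Θ m → z ≡ m)

  HasUniqueMinimal : (Pair → Set) → Set
  HasUniqueMinimal D = ∃[ m ] (MinimalIn D m × (∀ m′ → MinimalIn D m′ → m′ ≡ m))

{-# OPTIONS --safe #-}
module Submission where

-- Write R₁ = ρ₁(t), U = ρ₁(u), R₂ = ρ₂(t) = R₁ ∪ U, and let S₀ be the set of vertices of R₂
-- whose preorder label is at most u.  The least element of Δ(x₂) ∖ Δ(x₁) is m₀ = (μ₀, σ₀),
-- where σ₀ hangs S₀ at t and singletons everywhere else, and μ₀ is the preorder with the gap
-- [t, u] ∖ R₂ moved to just after u; the inversions of μ₀ are the pairs (a, b) with a in the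
-- gap and b ∈ S₀.
-- Let (μ, σ) ≤ x₂.  If u ∉ σ(t), then σ(t) ⊆ R₁, because an element of U in the block σ(t)
-- would pull in u, which lies between it and t in μ; so (μ, σ) ≤ x₁.  Otherwise the block
-- σ(t) contains t and u, and every other x ∈ S₀ lies in R₁, so it precedes u in λ₁ and hence
-- in μ; thus S₀ ⊆ σ(t).  A gap vertex a is a descendant of t outside σ(t) ⊆ R₂, so it cannot
-- precede any b ∈ S₀ in μ, and μ₀ ≤ μ.

open import Defs
open import Data.Product using (_×_)
open import Relation.Nullary using (¬_)

open import Data.Empty using (⊥-elim)
open import Data.Fin as Fin using (Fin; toℕ; fromℕ<; punchOut)
open import Data.Fin.Induction using (<-wellFounded)
import Data.Fin.Properties as Finₚ
open import Data.Fin.Subset using (Subset; _∈_; _∉_; _⊆_; _∪_; ∣_∣; ⁅_⁆)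
open import Data.Fin.Subset.Properties
  using (_∈?_; ⊆⊤; ∈⊤; ∣⊤∣≡n; p⊂q⇒∣p∣<∣q∣; x∈⁅x⁆; x∈⁅y⁆⇒x≡y; x∈p∪q⁻; q⊆p∪q; ⊆-antisym)
open import Data.List using ([]; _∷_)
open import Data.Nat using (ℕ; zero; suc; _+_; _≤_; _<_; z≤n; s≤s)
open import Data.Nat.Properties
open import Data.Product using (∃-syntax; _,_; proj₁; proj₂)
open import Data.Product.Relation.Binary.Lex.Strict
  using (×-Lex; ×-transitive; ×-irreflexive; ×-decidable; ×-compare)
open import Data.Sum using (_⊎_; inj₁; inj₂)
open import Data.Vec using (Vec; lookup; tabulate; _[_]≔_)
open import Data.Vec.Properties
  using (lookup∘tabulate; tabulate∘lookup; tabulate-cong; []=⇒lookup; lookup⇒[]=; lookup∘update; lookup∘update′)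
open import Induction.WellFounded using (Acc; acc)
open import Relation.Binary using (tri<; tri≈; tri>)
open import Relation.Binary.PropositionalEquality
open import Relation.Nullary using (Dec; yes; no; does)
open import Relation.Nullary.Decidable using (map′; dec-true; _×-dec_)

module _ {n} {P : Fin n → Set} (P? : ∀ x → Dec (P x)) where

  subsetOf : Subset n
  subsetOf = tabulate (λ x → does (P? x))

  ∈-subsetOf⁺ : ∀ {x} → P x → x ∈ subsetOf
  ∈-subsetOf⁺ {x} px = lookup⇒[]= x subsetOf (trans (lookup∘tabulate _ x) (dec-true (P? x) px))

  ∈-subsetOf⁻ : ∀ {x} → x ∈ subsetOf → P x
  ∈-subsetOf⁻ {x} x∈ with P? x | trans (sym (lookup∘tabulate (λ y → does (P? y)) x)) ([]=⇒lookup x∈)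
  ... | yes px | _ = px
  ... | no _   | ()

_↾_ : ∀ {n} → Subset n → ℕ → Subset n
R ↾ b = subsetOf (λ x → x ∈? R ×-dec toℕ x ≤? b)

∈-↾⁺ : ∀ {n} {R : Subset n} {b x} → x ∈ R → toℕ x ≤ b → x ∈ R ↾ b
∈-↾⁺ {R = R} {b} x∈R x≤b = ∈-subsetOf⁺ (λ y → y ∈? R ×-dec toℕ y ≤? b) (x∈R , x≤b)

∈-↾⁻ : ∀ {n} {R : Subset n} {b x} → x ∈ R ↾ b → x ∈ R × toℕ x ≤ b
∈-↾⁻ {R = R} {b} = ∈-subsetOf⁻ (λ y → y ∈? R ×-dec toℕ y ≤? b)

lookup-ext : ∀ {A : Set} {m} {xs ys : Vec A m} → (∀ i → lookup xs i ≡ lookup ys i) → xs ≡ ys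
lookup-ext {xs = xs} {ys} xs≗ys = trans (sym (tabulate∘lookup xs)) (trans (tabulate-cong xs≗ys) (tabulate∘lookup ys))

injective⇒surjective : ∀ {m} (f : Fin m → Fin m) → (∀ i j → f i ≡ f j → i ≡ j) →
                       ∀ y → ∃[ i ] f i ≡ y
injective⇒surjective {zero}  f f-inj ()
injective⇒surjective {suc m} f f-inj y with Finₚ.any? (λ i → f i Finₚ.≟ y)
... | yes hit = hit
... | no miss = ⊥-elim (1+n≰n (Finₚ.injective⇒≤ {f = g} g-inj))
  where
  g : Fin (suc m) → Fin m
  g i = punchOut {i = y} {j = f i} (λ e → miss (i , sym e))
  g-inj : ∀ {i j} → g i ≡ g j → i ≡ j
  g-inj {i} {j} e = f-inj i j (Finₚ.punchOut-injective (λ e′ → miss (i , sym e′)) (λ e′ → miss (j , sym e′)) e)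

-- Preorder labels of a plane forest

data Split (c : PTree) : ℕ → Set where
  inHead : ∀ {x} → x < size c → Split c x
  inTail : ∀ x → Split c (size c + x)

split : ∀ c x → Split c x
split c x with x <? size c
... | yes x<c = inHead x<c
... | no x≮c with m≤n⇒∃[o]m+o≡n (≮⇒≥ x≮c)
...   | o , refl = inTail o

mutual
  Anc⇒<size : ∀ {t x y} → Anc t x y → y < size t
  Anc⇒<size (root y<t) = y<t
  Anc⇒<size (down p)   = s≤s (AncF⇒<fsize p)

  AncF⇒<fsize : ∀ {F x y} → AncF F x y → y < fsize F
  AncF⇒<fsize {c ∷ cs} (here p)  = <-≤-trans (Anc⇒<size p) (m≤m+n (size c) (fsize cs))
  AncF⇒<fsize {c ∷ cs} (there p) = +-monoʳ-< (size c) (AncF⇒<fsize p)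

mutual
  Anc⇒≤ : ∀ {t x y} → Anc t x y → x ≤ y
  Anc⇒≤ (root _) = z≤n
  Anc⇒≤ (down p) = s≤s (AncF⇒≤ p)

  AncF⇒≤ : ∀ {F x y} → AncF F x y → x ≤ y
  AncF⇒≤ (here p)          = Anc⇒≤ p
  AncF⇒≤ {c ∷ _} (there p) = +-monoʳ-≤ (size c) (AncF⇒≤ p)

mutual
  Anc-refl : ∀ t {x} → x < size t → Anc t x x
  Anc-refl (node ts) {zero}  x<t       = root x<t
  Anc-refl (node ts) {suc x} (s≤s x<t) = down (AncF-refl ts x<t)

  AncF-refl : ∀ F {x} → x < fsize F → AncF F x x
  AncF-refl (c ∷ cs) {x} x<F with split c x
  ... | inHead x<c = here (Anc-refl c x<c)
  ... | inTail x′  = there (AncF-refl cs (+-cancelˡ-< (size c) _ _ x<F))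

AncF-head⁻ : ∀ {c cs x y} → x < size c → AncF (c ∷ cs) x y → Anc c x y
AncF-head⁻ _ (here p) = p
AncF-head⁻ {c} x<c (there {u = x′} _) = ⊥-elim (m+n≮m (size c) x′ x<c)

AncF-tail⁻ : ∀ {c cs x z} → AncF (c ∷ cs) (size c + x) z →
             ∃[ z′ ] (z ≡ size c + z′ × AncF cs x z′)
AncF-tail⁻ {c} {cs} {x} {z} p = go p refl
  where
  go : ∀ {w} → AncF (c ∷ cs) w z → w ≡ size c + x → ∃[ z′ ] (z ≡ size c + z′ × AncF cs x z′)
  go (here q) refl = ⊥-elim (m+n≮m (size c) x (≤-<-trans (Anc⇒≤ q) (Anc⇒<size q)))
  go (there q) e with refl ← +-cancelˡ-≡ (size c) _ _ e = _ , refl , q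

AncF-there⁻ : ∀ {c cs x y} → AncF (c ∷ cs) (size c + x) (size c + y) → AncF cs x y
AncF-there⁻ {c} p with AncF-tail⁻ p
... | _ , e , q with refl ← +-cancelˡ-≡ (size c) _ _ e = q

mutual
  Anc-trans : ∀ {t x y z} → Anc t x y → Anc t y z → Anc t x z
  Anc-trans (root _) q        = root (Anc⇒<size q)
  Anc-trans (down p) (down q) = down (AncF-trans p q)

  AncF-trans : ∀ {F x y z} → AncF F x y → AncF F y z → AncF F x z
  AncF-trans (here p) (here q) = here (Anc-trans p q)
  AncF-trans {c ∷ _} (here p) (there {u = y′} _) = ⊥-elim (m+n≮m (size c) y′ (Anc⇒<size p))
  AncF-trans (there p) q with AncF-tail⁻ q
  ... | _ , refl , q′ = there (AncF-trans p q′)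

mutual
  Anc-interval : ∀ {t x y z} → Anc t x z → x ≤ y → y ≤ z → Anc t x y
  Anc-interval (root z<t) _ y≤z = root (≤-<-trans y≤z z<t)
  Anc-interval {y = suc y} (down p) (s≤s x≤y) (s≤s y≤z) = down (AncF-interval p x≤y y≤z)

  AncF-interval : ∀ {F x y z} → AncF F x z → x ≤ y → y ≤ z → AncF F x y
  AncF-interval (here p) x≤y y≤z = here (Anc-interval p x≤y y≤z)
  AncF-interval {c ∷ _} {y = y} (there {u = x′} p) x≤y y≤z with split c y
  ... | inHead y<c = ⊥-elim (m+n≮m (size c) x′ (≤-<-trans x≤y y<c))
  ... | inTail y′  = there (AncF-interval p (+-cancelˡ-≤ (size c) _ _ x≤y) (+-cancelˡ-≤ (size c) _ _ y≤z))

mutual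
  Anc? : ∀ t x y → Dec (Anc t x y)
  Anc? (node ts) zero    y       = map′ root Anc⇒<size (y <? size (node ts))
  Anc? (node ts) (suc x) zero    = no λ ()
  Anc? (node ts) (suc x) (suc y) = map′ down (λ { (down p) → p }) (AncF? ts x y)

  AncF? : ∀ F x y → Dec (AncF F x y)
  AncF? []       x y = no λ ()
  AncF? (c ∷ cs) x y with split c x | split c y
  ... | inHead x<c | _          = map′ here (AncF-head⁻ x<c) (Anc? c x y)
  ... | inTail x′  | inHead y<c = no λ p → m+n≮m (size c) x′ (≤-<-trans (AncF⇒≤ p) y<c)
  ... | inTail x′  | inTail y′  = map′ there AncF-there⁻ (AncF? cs x′ y′)

module _ (T : PTree) where

  private
    n : ℕ
    n = N T

    _⊑_ : Fin n → Fin n → Set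
    _⊑_ = _≤T_ T

  ⊑-refl : ∀ x → x ⊑ x
  ⊑-refl x = AncF-refl (children T) (Finₚ.toℕ<n x)

  ⊑-trans : ∀ {x y z} → x ⊑ y → y ⊑ z → x ⊑ z
  ⊑-trans = AncF-trans

  ⊑⇒≤ : ∀ {x y} → x ⊑ y → toℕ x ≤ toℕ y
  ⊑⇒≤ = AncF⇒≤

  ⊑-antisym : ∀ {x y} → x ⊑ y → y ⊑ x → x ≡ y
  ⊑-antisym x⊑y y⊑x = Finₚ.toℕ-injective (≤-antisym (⊑⇒≤ x⊑y) (⊑⇒≤ y⊑x))

  ⊑-interval : ∀ {x y z} → x ⊑ z → toℕ x ≤ toℕ y → toℕ y ≤ toℕ z → x ⊑ y
  ⊑-interval = AncF-interval

  ⊑-chain : ∀ {x y z} → x ⊑ z → y ⊑ z → x ⊑ y ⊎ y ⊑ x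
  ⊑-chain {x} {y} x⊑z y⊑z with ≤-total (toℕ x) (toℕ y)
  ... | inj₁ x≤y = inj₁ (⊑-interval x⊑z x≤y (⊑⇒≤ y⊑z))
  ... | inj₂ y≤x = inj₂ (⊑-interval y⊑z y≤x (⊑⇒≤ x⊑z))

  _⊑?_ : ∀ x y → Dec (x ⊑ y)
  x ⊑? y = AncF? (children T) (toℕ x) (toℕ y)

  <T⇒< : ∀ {x y} → _<T_ T x y → toℕ x < toℕ y
  <T⇒< (x⊑y , x≢y) = ≤∧≢⇒< (⊑⇒≤ x⊑y) (λ e → x≢y (Finₚ.toℕ-injective e))

  -- Walks and ornaments

  Walk-head : ∀ {S a b} → Walk T S a b → a ∈ S
  Walk-head (stop a∈S)     = a∈S
  Walk-head (step a∈S _ _) = a∈S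

  _++ʷ_ : ∀ {S a b c} → Walk T S a b → Walk T S b c → Walk T S a c
  stop _         ++ʷ w′ = w′
  step a∈S a~c w ++ʷ w′ = step a∈S a~c (w ++ʷ w′)

  Adjacent-sym : ∀ {a b} → Adjacent T a b → Adjacent T b a
  Adjacent-sym (inj₁ a⋖b) = inj₂ a⋖b
  Adjacent-sym (inj₂ b⋖a) = inj₁ b⋖a

  reverseʷ : ∀ {S a b} → Walk T S a b → Walk T S b a
  reverseʷ (stop a∈S)       = stop a∈S
  reverseʷ (step a∈S a~c w) = reverseʷ w ++ʷ step (Walk-head w) (Adjacent-sym a~c) (stop a∈S)

  Walk-enters : ∀ {S a b x} → Walk T S a b → x ⊑ b → ¬ x ⊑ a →
                x ∈ S × ∃[ p ] (p ∈ S × _⋖T_ T p x)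
  Walk-enters (stop _) x⊑b x⋢a = ⊥-elim (x⋢a x⊑b)
  Walk-enters {x = x} (step {c = c} a∈S a~c w) x⊑b x⋢a with x ⊑? c
  ... | no x⋢c = Walk-enters w x⊑b x⋢c
  ... | yes x⊑c with a~c
  ...   | inj₂ ((c⊑a , _) , _) = ⊥-elim (x⋢a (⊑-trans x⊑c c⊑a))
  ...   | inj₁ a⋖c@((a⊑c , _) , a⋖c-tight) with ⊑-chain x⊑c a⊑c
  ...     | inj₁ x⊑a = ⊥-elim (x⋢a x⊑a)
  ...     | inj₂ a⊑x with a⋖c-tight x a⊑x x⊑c
  ...       | inj₁ refl = ⊥-elim (x⋢a (⊑-refl x))
  ...       | inj₂ refl = Walk-head w , _ , a∈S , a⋖c

  OrnamentAt-convex : ∀ {t S x y} → OrnamentAt T t S → toℕ t ≤ toℕ x → x ⊑ y → y ∈ S → x ∈ S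
  OrnamentAt-convex {t} {S} {x} (connected , t∈S , t-min) t≤x x⊑y y∈S with ⊑-chain x⊑y (t-min _ y∈S)
  ... | inj₁ x⊑t = subst (_∈ S) (Finₚ.toℕ-injective (≤-antisym t≤x (⊑⇒≤ x⊑t))) t∈S
  ... | inj₂ t⊑x with x Finₚ.≟ t
  ...   | yes refl = t∈S
  ...   | no x≢t = proj₁ (Walk-enters (connected t _ t∈S y∈S) x⊑y (λ x⊑t → x≢t (⊑-antisym x⊑t t⊑x)))

  ⁅⁆-OrnamentAt : ∀ v → OrnamentAt T v ⁅ v ⁆
  ⁅⁆-OrnamentAt v = connected , x∈⁅x⁆ v , λ w w∈ → subst (v ⊑_) (sym (x∈⁅y⁆⇒x≡y v w∈)) (⊑-refl v)
    where
    connected : Connected T ⁅ v ⁆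
    connected a b a∈ b∈ with x∈⁅y⁆⇒x≡y v a∈ | x∈⁅y⁆⇒x≡y v b∈
    ... | refl | refl = stop a∈

  OrnamentAt-↾ : ∀ {t R b} → OrnamentAt T t R → toℕ t ≤ b → OrnamentAt T t (R ↾ b)
  OrnamentAt-↾ {t} {R} {b} (connected , t∈R , t-min) t≤b =
    (λ x y x∈ y∈ → walk-to-t x x∈ (<-wellFounded x) ++ʷ reverseʷ (walk-to-t y y∈ (<-wellFounded y))) ,
    ∈-↾⁺ t∈R t≤b ,
    λ w w∈ → t-min w (proj₁ (∈-↾⁻ w∈))
    where
    walk-to-t : ∀ x → x ∈ R ↾ b → Acc Fin._<_ x → Walk T (R ↾ b) x t
    walk-to-t x x∈ (acc rec) with x Finₚ.≟ t | ∈-↾⁻ x∈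
    ... | yes refl | _ = stop x∈
    ... | no x≢t | x∈R , x≤b
      with Walk-enters (connected t x t∈R x∈R) (⊑-refl x) (λ x⊑t → x≢t (⊑-antisym x⊑t (t-min x x∈R)))
    ...   | _ , p , p∈R , p⋖x = step x∈ (inj₂ p⋖x) (walk-to-t p p∈ (rec p<x))
      where
      p<x : toℕ p < toℕ x
      p<x = <T⇒< (proj₁ p⋖x)
      p∈ : p ∈ R ↾ b
      p∈ = ∈-↾⁺ p∈R (≤-trans (<⇒≤ p<x) x≤b)

  singletons : Vec (Subset n) n
  singletons = tabulate ⁅_⁆

  data Entry (t : Fin n) (S : Subset n) (v : Fin n) : Subset n → Set where
    replaced  : v ≡ t → Entry t S v S
    singleton : v ≢ t → Entry t S v ⁅ v ⁆

  entry : ∀ t S v → Entry t S v (lookup (singletons [ t ]≔ S) v)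
  entry t S v with v Finₚ.≟ t
  ... | yes refl = subst (Entry t S t) (sym (lookup∘update t singletons S)) (replaced refl)
  ... | no v≢t   = subst (Entry t S v) (sym (trans (lookup∘update′ v≢t singletons S) (lookup∘tabulate ⁅_⁆ v)))
                         (singleton v≢t)

  Disjoint-sym : ∀ {A B} → Disjoint T A B → Disjoint T B A
  Disjoint-sym A∩B=∅ x (x∈B , x∈A) = A∩B=∅ x (x∈A , x∈B)

  ⁅⁆-nested : ∀ v S → ⁅ v ⁆ ⊆ S ⊎ Disjoint T ⁅ v ⁆ S
  ⁅⁆-nested v S with v ∈? S
  ... | yes v∈S = inj₁ λ x∈ → subst (_∈ S) (sym (x∈⁅y⁆⇒x≡y v x∈)) v∈S
  ... | no v∉S  = inj₂ λ x (x∈⁅v⁆ , x∈S) → v∉S (subst (_∈ S) (x∈⁅y⁆⇒x≡y v x∈⁅v⁆) x∈S)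

  singletons[]≔-Ornamentation : ∀ {t S} → OrnamentAt T t S → Ornamentation T (singletons [ t ]≔ S)
  singletons[]≔-Ornamentation {t} {S} S-orn = ornament , nested
    where
    σ = singletons [ t ]≔ S

    ornament : ∀ v → OrnamentAt T v (lookup σ v)
    ornament v with lookup σ v | entry t S v
    ... | _ | replaced refl = S-orn
    ... | _ | singleton _   = ⁅⁆-OrnamentAt v

    nested : ∀ v w → lookup σ v ⊆ lookup σ w ⊎ lookup σ w ⊆ lookup σ v ⊎ Disjoint T (lookup σ v) (lookup σ w)
    nested v w with lookup σ v | entry t S v | lookup σ w | entry t S w
    ... | _ | replaced _  | _ | replaced _  = inj₁ λ x∈ → x∈
    ... | _ | replaced _  | _ | singleton _ with ⁅⁆-nested w S
    ...   | inj₁ ⁅w⁆⊆S = inj₂ (inj₁ ⁅w⁆⊆S)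
    ...   | inj₂ disj  = inj₂ (inj₂ (Disjoint-sym disj))
    nested v w | _ | singleton _ | _ | replaced _ with ⁅⁆-nested v S
    ...   | inj₁ ⁅v⁆⊆S = inj₁ ⁅v⁆⊆S
    ...   | inj₂ disj  = inj₂ (inj₂ disj)
    nested v w | _ | singleton _ | _ | singleton _ with ⁅⁆-nested v ⁅ w ⁆
    ...   | inj₁ ⁅v⁆⊆⁅w⁆ = inj₁ ⁅v⁆⊆⁅w⁆
    ...   | inj₂ disj    = inj₂ (inj₂ disj)

  hook∈ : ∀ ρ → Ornamentation T ρ → ∀ v → v ∈ lookup ρ v
  hook∈ _ (ornament , _) v = proj₁ (proj₂ (ornament v))

  hook⊑ : ∀ ρ → Ornamentation T ρ → ∀ v {w} → w ∈ lookup ρ v → v ⊑ w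
  hook⊑ _ (ornament , _) v = proj₂ (proj₂ (ornament v)) _

  singletons[]≔-≤ : ∀ {t S} ρ → Ornamentation T ρ → S ⊆ lookup ρ t →
                    OrnLeq T (singletons [ t ]≔ S) ρ
  singletons[]≔-≤ {t} {S} ρ ρ-orn S⊆ρt v with lookup (singletons [ t ]≔ S) v | entry t S v
  ... | _ | replaced refl = S⊆ρt
  ... | _ | singleton _   = λ x∈ → subst (_∈ lookup ρ v) (sym (x∈⁅y⁆⇒x≡y v x∈)) (hook∈ ρ ρ-orn v)

  -- Linear extensions and the weak order

  module _ (μ : Vec (Fin n) n) (μ-perm : IsPerm T μ) where

    position : ∀ x → ∃[ i ] lookup μ i ≡ x
    position = injective⇒surjective (lookup μ) μ-perm

    Precedes-irrefl : ∀ {x} → ¬ Precedes T μ x x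
    Precedes-irrefl (i , j , i<j , refl , eʲ) = <-irrefl (cong toℕ (μ-perm i j (sym eʲ))) i<j

    Precedes-asym : ∀ {x y} → Precedes T μ x y → ¬ Precedes T μ y x
    Precedes-asym (i , j , i<j , refl , refl) (k , l , k<l , eᵏ , eˡ)
      with refl ← μ-perm i l (sym eˡ) | refl ← μ-perm j k (sym eᵏ) = <-asym i<j k<l

    Precedes-connex : ∀ {x y} → x ≢ y → Precedes T μ x y ⊎ Precedes T μ y x
    Precedes-connex {x} {y} x≢y with position x | position y
    ... | i , eⁱ | j , eʲ with Finₚ.<-cmp i j
    ...   | tri< i<j _ _ = inj₁ (i , j , i<j , eⁱ , eʲ)
    ...   | tri≈ _ refl _ = ⊥-elim (x≢y (trans (sym eⁱ) eʲ))
    ...   | tri> _ _ j<i = inj₂ (j , i , j<i , eʲ , eⁱ)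

    Consecutive-between : ∀ {S x y z} → Consecutive T μ S →
                          Precedes T μ x y → Precedes T μ y z → x ∈ S → z ∈ S → y ∈ S
    Consecutive-between cons (i , j , i<j , refl , refl) (j′ , k , j′<k , eʲ′ , refl) x∈S z∈S
      with refl ← μ-perm j′ j eʲ′ = cons i j k (<⇒≤ i<j) (<⇒≤ j′<k) x∈S z∈S

    Consecutive-⁅⁆ : ∀ v → Consecutive T μ ⁅ v ⁆
    Consecutive-⁅⁆ v i j k i≤j j≤k i∈ k∈
      with refl ← μ-perm i k (trans (x∈⁅y⁆⇒x≡y v i∈) (sym (x∈⁅y⁆⇒x≡y v k∈)))
      with refl ← Finₚ.toℕ-injective {i = i} {j = j} (≤-antisym i≤j j≤k) = i∈

  AfterBlock⇒∉ : ∀ μ {S u} → AfterBlock T μ S u → u ∉ S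
  AfterBlock⇒∉ _ (i , i′ , _ , last , i′≡1+i , refl) u∈S = 1+n≰n (subst (_≤ toℕ i) i′≡1+i (last i′ u∈S))

  AfterBlock⇒Precedes : ∀ μ {S u x} → IsPerm T μ → AfterBlock T μ S u → x ∈ S → Precedes T μ x u
  AfterBlock⇒Precedes μ {x = x} μ-perm (i , i′ , _ , last , i′≡1+i , eᵘ) x∈S with position μ μ-perm x
  ... | k , refl = k , i′ , subst (toℕ k <_) (sym i′≡1+i) (s≤s (last k x∈S)) , refl , eᵘ

  singletons[]≔-Consecutive : ∀ μ {t S} → IsPerm T μ → Consecutive T μ S →
                              ∀ v → Consecutive T μ (lookup (singletons [ t ]≔ S) v)
  singletons[]≔-Consecutive μ {t} {S} μ-perm S-cons v with lookup (singletons [ t ]≔ S) v | entry t S v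
  ... | _ | replaced _  = S-cons
  ... | _ | singleton _ = Consecutive-⁅⁆ μ μ-perm v

  WeakLeq-antisym : ∀ {μ μ′} → IsPerm T μ → IsPerm T μ′ → WeakLeq T μ μ′ → WeakLeq T μ′ μ → μ ≡ μ′
  WeakLeq-antisym {μ} {μ′} μ-perm μ′-perm μ≤μ′ μ′≤μ =
    lookup-ext (λ k → agree k (<-wellFounded k))
    where
    transfer : ∀ {x y} → Precedes T μ x y → Precedes T μ′ x y
    transfer {x} {y} x≺y with Finₚ.<-cmp x y
    ... | tri≈ _ refl _ = ⊥-elim (Precedes-irrefl μ μ-perm x≺y)
    ... | tri> _ _ y<x  = μ≤μ′ y x y<x x≺y
    ... | tri< x<y x≢y _ with Precedes-connex μ′ μ′-perm x≢y
    ...   | inj₁ x≺′y = x≺′y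
    ...   | inj₂ y≺′x = ⊥-elim (Precedes-asym μ μ-perm x≺y (μ′≤μ x y x<y y≺′x))

    -- μ′ k = μ j: j < k contradicts agreement at j, and j > k would put μ k before μ′ k
    -- in μ′ as well, at some position a < k, contradicting agreement at a.
    agree : ∀ k → Acc Fin._<_ k → lookup μ k ≡ lookup μ′ k
    agree k (acc rec) with position μ μ-perm (lookup μ′ k)
    ... | j , eʲ with Finₚ.<-cmp j k
    ...   | tri≈ _ refl _ = eʲ
    ...   | tri< j<k _ _  = ⊥-elim (<-irrefl (cong toℕ (μ′-perm j k (trans (sym (agree j (rec j<k))) eʲ))) j<k)
    ...   | tri> _ _ k<j with transfer (k , j , k<j , refl , eʲ)
    ...     | a , b , a<b , eᵃ , eᵇ with refl ← μ′-perm b k eᵇ =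
      ⊥-elim (<-irrefl (cong toℕ (μ-perm a b (trans (agree a (rec a<b)) eᵃ))) a<b)

  ≤Θ-antisym : ∀ {x y} → InTheta T x → InTheta T y → _≤Θ_ T x y → _≤Θ_ T y x → x ≡ y
  ≤Θ-antisym {μ , σ} {μ′ , σ′} ((μ-perm , _) , _) ((μ′-perm , _) , _) (μ≤μ′ , σ≤σ′) (μ′≤μ , σ′≤σ) =
    cong₂ _,_ (WeakLeq-antisym μ-perm μ′-perm μ≤μ′ μ′≤μ) (lookup-ext λ v → ⊆-antisym (σ≤σ′ v) (σ′≤σ v))

  least⇒HasUniqueMinimal : ∀ {D} m → (∀ z → D z → InTheta T z) → D m → (∀ z → D z → _≤Θ_ T m z) →
                           HasUniqueMinimal T D
  least⇒HasUniqueMinimal {D} m D⊆Θ m∈D m-least =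
    m , (m∈D , λ z z∈D z≤m → ≤Θ-antisym (D⊆Θ z z∈D) (D⊆Θ m m∈D) z≤m (m-least z z∈D)) ,
    λ m′ (m′∈D , m′-minimal) → sym (m′-minimal m m∈D (m-least m′ m′∈D))

  module SortOn (key : Fin n → ℕ) where

    _≺_ : Fin n → Fin n → Set
    x ≺ y = ×-Lex _≡_ _<_ _<_ (key x , toℕ x) (key y , toℕ y)

    ≺-trans : ∀ {x y z} → x ≺ y → y ≺ z → x ≺ z
    ≺-trans {x} {y} {z} = ×-transitive {_≈₁_ = _≡_} {_<₁_ = _<_} {_<₂_ = _<_} isEquivalence (resp₂ _<_) <-trans <-trans
      {key x , toℕ x} {key y , toℕ y} {key z , toℕ z}

    ≺-irrefl : ∀ {x} → ¬ x ≺ x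
    ≺-irrefl {x} = ×-irreflexive {_≈₁_ = _≡_} {_<₁_ = _<_} {_≈₂_ = _≡_} {_<₂_ = _<_} <-irrefl <-irrefl {key x , toℕ x} (refl , refl)

    _≺?_ : ∀ x y → Dec (x ≺ y)
    x ≺? y = ×-decidable _≟_ _<?_ _<?_ (key x , toℕ x) (key y , toℕ y)

    ≺-connex : ∀ {x y} → x ≢ y → x ≺ y ⊎ y ≺ x
    ≺-connex {x} {y} x≢y with ×-compare sym <-cmp <-cmp (key x , toℕ x) (key y , toℕ y)
    ... | tri< x≺y _ _     = inj₁ x≺y
    ... | tri≈ _ (_ , e) _ = ⊥-elim (x≢y (Finₚ.toℕ-injective e))
    ... | tri> _ _ y≺x     = inj₂ y≺x

    key≤∧<⇒≺ : ∀ {x y} → key x ≤ key y → toℕ x < toℕ y → x ≺ y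
    key≤∧<⇒≺ kx≤ky x<y with m≤n⇒m<n∨m≡n kx≤ky
    ... | inj₁ kx<ky = inj₁ kx<ky
    ... | inj₂ kx≡ky = inj₂ (kx≡ky , x<y)

    ≺∧>⇒key< : ∀ {x y} → x ≺ y → toℕ y < toℕ x → key x < key y
    ≺∧>⇒key< (inj₁ kx<ky)     _   = kx<ky
    ≺∧>⇒key< (inj₂ (_ , x<y)) y<x = ⊥-elim (<-asym x<y y<x)

    below : Fin n → Subset n
    below x = subsetOf (_≺? x)

    ∣below∣<n : ∀ x → ∣ below x ∣ < n
    ∣below∣<n x = subst (∣ below x ∣ <_) (∣⊤∣≡n n)
      (p⊂q⇒∣p∣<∣q∣ (⊆⊤ , x , ∈⊤ , λ x∈ → ≺-irrefl (∈-subsetOf⁻ (_≺? x) x∈)))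

    rank : Fin n → Fin n
    rank x = fromℕ< (∣below∣<n x)

    rank-mono : ∀ {x y} → x ≺ y → rank x Fin.< rank y
    rank-mono {x} {y} x≺y = subst₂ _<_ (sym (Finₚ.toℕ-fromℕ< (∣below∣<n x))) (sym (Finₚ.toℕ-fromℕ< (∣below∣<n y)))
      (p⊂q⇒∣p∣<∣q∣ ((λ w∈ → ∈-subsetOf⁺ (_≺? y) (≺-trans (∈-subsetOf⁻ (_≺? x) w∈) x≺y)) ,
                    x , ∈-subsetOf⁺ (_≺? y) x≺y , λ x∈ → ≺-irrefl (∈-subsetOf⁻ (_≺? x) x∈)))

    rank-injective : ∀ x y → rank x ≡ rank y → x ≡ y
    rank-injective x y e with x Finₚ.≟ y
    ... | yes x≡y = x≡y
    ... | no x≢y with ≺-connex x≢y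
    ...   | inj₁ x≺y = ⊥-elim (<-irrefl (cong toℕ e) (rank-mono x≺y))
    ...   | inj₂ y≺x = ⊥-elim (<-irrefl (cong toℕ (sym e)) (rank-mono y≺x))

    sorted : Vec (Fin n) n
    sorted = tabulate (λ i → proj₁ (injective⇒surjective rank rank-injective i))

    rank-sorted : ∀ i → rank (lookup sorted i) ≡ i
    rank-sorted i = trans (cong rank (lookup∘tabulate _ i)) (proj₂ (injective⇒surjective rank rank-injective i))

    sorted-rank : ∀ x → lookup sorted (rank x) ≡ x
    sorted-rank x = rank-injective _ _ (rank-sorted (rank x))

    sorted-IsPerm : IsPerm T sorted
    sorted-IsPerm i j e = trans (sym (rank-sorted i)) (trans (cong rank e) (rank-sorted j))

    Precedes-sorted⁺ : ∀ {x y} → x ≺ y → Precedes T sorted x y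
    Precedes-sorted⁺ {x} {y} x≺y = rank x , rank y , rank-mono x≺y , sorted-rank x , sorted-rank y

    Precedes-sorted⁻ : ∀ {x y} → Precedes T sorted x y → x ≺ y
    Precedes-sorted⁻ (i , j , i<j , refl , refl) with ≺-connex (λ e → <-irrefl (cong toℕ (sorted-IsPerm i j e)) i<j)
    ... | inj₁ x≺y = x≺y
    ... | inj₂ y≺x = ⊥-elim (<-asym i<j (subst₂ Fin._<_ (rank-sorted j) (rank-sorted i) (rank-mono y≺x)))

    LinExt-sorted : (∀ x y → _<T_ T x y → x ≺ y) → LinExt T sorted
    LinExt-sorted <T⇒≺ = sorted-IsPerm , λ x y x<y → Precedes-sorted⁺ (<T⇒≺ x y x<y)

    Consecutive-sorted : ∀ {S} → (∀ {x y z} → x ∈ S → x ≺ y → y ≺ z → z ∈ S → y ∈ S) →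
                         Consecutive T sorted S
    Consecutive-sorted ≺-convex i j k i≤j j≤k i∈ k∈ with i Finₚ.≟ j | j Finₚ.≟ k
    ... | yes refl | _        = i∈
    ... | no _     | yes refl = k∈
    ... | no i≢j   | no j≢k   =
      ≺-convex i∈ (Precedes-sorted⁻ (i , j , Finₚ.≤∧≢⇒< i≤j i≢j , refl , refl))
                  (Precedes-sorted⁻ (j , k , Finₚ.≤∧≢⇒< j≤k j≢k , refl , refl)) k∈

  -- The least element of Δ(x₂) ∖ Δ(x₁)

  module AssociahedronMove
    (λ₁ : Vec (Fin n) n) (ρ₁ ρ₂ : Vec (Subset n) n)
    (λ₁-lin : LinExt T λ₁) (ρ₁-orn : Ornamentation T ρ₁) (ρ₂-orn : Ornamentation T ρ₂)
    (ρ₂-cons : ∀ v → Consecutive T λ₁ (lookup ρ₂ v))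
    (t u : Fin n) (u-after : AfterBlock T λ₁ (lookup ρ₁ t) u)
    (ρ-unchanged : ∀ v → v ≢ t → lookup ρ₁ v ≡ lookup ρ₂ v)
    (ρ-merged : lookup ρ₂ t ≡ lookup ρ₁ t ∪ lookup ρ₁ u)
    where

    private
      R₁ R₂ U : Subset n
      R₁ = lookup ρ₁ t
      R₂ = lookup ρ₂ t
      U  = lookup ρ₁ u

      λ₁-perm : IsPerm T λ₁
      λ₁-perm = proj₁ λ₁-lin

    u∈R₂ : u ∈ R₂
    u∈R₂ = subst (u ∈_) (sym ρ-merged) (q⊆p∪q R₁ U (hook∈ ρ₁ ρ₁-orn u))

    t⊑u : t ⊑ u
    t⊑u = hook⊑ ρ₂ ρ₂-orn t u∈R₂

    t≤u : toℕ t ≤ toℕ u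
    t≤u = ⊑⇒≤ t⊑u

    u∉R₁ : u ∉ R₁
    u∉R₁ = AfterBlock⇒∉ λ₁ u-after

    t≢u : t ≢ u
    t≢u t≡u = u∉R₁ (subst (_∈ R₁) t≡u (hook∈ ρ₁ ρ₁-orn t))

    S₀ : Subset n
    S₀ = R₂ ↾ toℕ u

    t∈S₀ : t ∈ S₀
    t∈S₀ = ∈-↾⁺ (hook∈ ρ₂ ρ₂-orn t) t≤u

    u∈S₀ : u ∈ S₀
    u∈S₀ = ∈-↾⁺ u∈R₂ ≤-refl

    S₀⊆R₂ : S₀ ⊆ R₂
    S₀⊆R₂ x∈ = proj₁ (∈-↾⁻ x∈)

    S₀⇒≤u : ∀ {x} → x ∈ S₀ → toℕ x ≤ toℕ u
    S₀⇒≤u x∈ = proj₂ (∈-↾⁻ x∈)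

    S₀⇒t≤ : ∀ {x} → x ∈ S₀ → toℕ t ≤ toℕ x
    S₀⇒t≤ x∈ = ⊑⇒≤ (hook⊑ ρ₂ ρ₂-orn t (S₀⊆R₂ x∈))

    S₀∖u⊆R₁ : ∀ {x} → x ∈ S₀ → x ≢ u → x ∈ R₁
    S₀∖u⊆R₁ {x} x∈ x≢u with x∈p∪q⁻ R₁ U (subst (x ∈_) ρ-merged (S₀⊆R₂ x∈))
    ... | inj₁ x∈R₁ = x∈R₁
    ... | inj₂ x∈U  = ⊥-elim (x≢u (Finₚ.toℕ-injective (≤-antisym (S₀⇒≤u x∈) (⊑⇒≤ (hook⊑ ρ₁ ρ₁-orn u x∈U)))))

    Gap : Fin n → Set
    Gap x = toℕ t ≤ toℕ x × toℕ x ≤ toℕ u × x ∉ R₂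

    data Block (x : Fin n) : ℕ → Set where
      before : toℕ x < toℕ t → Block x 0
      lower  : x ∈ S₀ → Block x 0
      gap    : Gap x → Block x 1
      after  : toℕ u < toℕ x → Block x 2

    key : Fin n → ℕ
    key x with toℕ u <? toℕ x | toℕ x <? toℕ t | x ∈? R₂
    ... | yes _ | _     | _     = 2
    ... | no _  | yes _ | _     = 0
    ... | no _  | no _  | yes _ = 0
    ... | no _  | no _  | no _  = 1

    block : ∀ x → Block x (key x)
    block x with toℕ u <? toℕ x | toℕ x <? toℕ t | x ∈? R₂
    ... | yes u<x | _       | _       = after u<x
    ... | no _    | yes x<t | _       = before x<t
    ... | no u≮x  | no _    | yes x∈R₂ = lower (∈-↾⁺ x∈R₂ (≮⇒≥ u≮x))
    ... | no u≮x  | no t≮x  | no x∉R₂  = gap (≮⇒≥ t≮x , ≮⇒≥ u≮x , x∉R₂)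

    key-mono : ∀ {x y} → x ⊑ y → key x ≤ key y
    key-mono {x} {y} x⊑y with ⊑⇒≤ x⊑y | key x | block x | key y | block y
    ... | _   | _ | before _ | _ | _ = z≤n
    ... | _   | _ | lower _  | _ | _ = z≤n
    ... | _   | _ | gap _    | _ | gap _   = ≤-refl
    ... | _   | _ | gap _    | _ | after _ = s≤s z≤n
    ... | x≤y | _ | gap (t≤x , _) | _ | before y<t = ⊥-elim (<⇒≱ y<t (≤-trans t≤x x≤y))
    ... | _   | _ | gap (t≤x , _ , x∉R₂) | _ | lower y∈S₀ =
      ⊥-elim (x∉R₂ (OrnamentAt-convex (proj₁ ρ₂-orn t) t≤x x⊑y (S₀⊆R₂ y∈S₀)))
    ... | _   | _ | after _   | _ | after _ = ≤-refl
    ... | x≤y | _ | after u<x | _ | before y<t = ⊥-elim (<⇒≱ u<x (≤-trans x≤y (≤-trans (<⇒≤ y<t) t≤u)))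
    ... | x≤y | _ | after u<x | _ | lower y∈S₀ = ⊥-elim (<⇒≱ u<x (≤-trans x≤y (S₀⇒≤u y∈S₀)))
    ... | x≤y | _ | after u<x | _ | gap (_ , y≤u , _) = ⊥-elim (<⇒≱ u<x (≤-trans x≤y y≤u))

    key-S₀ : ∀ {x} → x ∈ S₀ → key x ≡ 0
    key-S₀ {x} x∈S₀ with key x | block x
    ... | _ | before x<t         = refl
    ... | _ | lower _            = refl
    ... | _ | gap (_ , _ , x∉R₂) = ⊥-elim (x∉R₂ (S₀⊆R₂ x∈S₀))
    ... | _ | after u<x          = ⊥-elim (<⇒≱ u<x (S₀⇒≤u x∈S₀))

    key≡0⇒S₀ : ∀ {x} → key x ≡ 0 → toℕ t ≤ toℕ x → x ∈ S₀
    key≡0⇒S₀ {x} kx≡0 t≤x with key x | block x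
    key≡0⇒S₀ _  t≤x | _ | before x<t = ⊥-elim (<⇒≱ x<t t≤x)
    key≡0⇒S₀ _  _   | _ | lower x∈S₀ = x∈S₀
    key≡0⇒S₀ () _   | _ | gap _
    key≡0⇒S₀ () _   | _ | after _

    key-inversion : ∀ {a b} → toℕ a < toℕ b → key b < key a → Gap a × b ∈ S₀
    key-inversion {a} {b} a<b kb<ka with key a | block a | key b | block b
    key-inversion _   () | _ | before _ | _ | _
    key-inversion _   () | _ | lower _  | _ | _
    key-inversion a<b _  | _ | gap (t≤a , _) | _ | before b<t = ⊥-elim (<-asym a<b (<-≤-trans b<t t≤a))
    key-inversion _   _  | _ | gap a-gap | _ | lower b∈S₀ = a-gap , b∈S₀
    key-inversion _   (s≤s ()) | _ | gap _ | _ | gap _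
    key-inversion _   (s≤s ()) | _ | gap _ | _ | after _
    key-inversion a<b _  | _ | after u<a | _ | before b<t = ⊥-elim (<-asym a<b (<-trans b<t (≤-<-trans t≤u u<a)))
    key-inversion a<b _  | _ | after u<a | _ | lower b∈S₀ = ⊥-elim (<-asym a<b (≤-<-trans (S₀⇒≤u b∈S₀) u<a))
    key-inversion a<b _  | _ | after u<a | _ | gap (_ , b≤u , _) = ⊥-elim (<-asym a<b (≤-<-trans b≤u u<a))
    key-inversion _   (s≤s (s≤s ())) | _ | after _ | _ | after _

    open SortOn key

    μ₀ : Vec (Fin n) n
    μ₀ = sorted

    σ₀ : Vec (Subset n) n
    σ₀ = singletons [ t ]≔ S₀

    m₀ : Pair T
    m₀ = μ₀ , σ₀

    S₀-≺-convex : ∀ {x y z} → x ∈ S₀ → x ≺ y → y ≺ z → z ∈ S₀ → y ∈ S₀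
    S₀-≺-convex {x} {y} {z} _ _ (inj₁ ky<kz) z∈S₀ = ⊥-elim (n≮0 (subst (key y <_) (key-S₀ z∈S₀) ky<kz))
    S₀-≺-convex x∈S₀ (inj₁ kx<ky) (inj₂ (ky≡kz , _)) z∈S₀ =
      ⊥-elim (<-irrefl (trans (key-S₀ x∈S₀) (sym (trans ky≡kz (key-S₀ z∈S₀)))) kx<ky)
    S₀-≺-convex x∈S₀ (inj₂ (_ , x<y)) (inj₂ (ky≡kz , _)) z∈S₀ =
      key≡0⇒S₀ (trans ky≡kz (key-S₀ z∈S₀)) (≤-trans (S₀⇒t≤ x∈S₀) (<⇒≤ x<y))

    m₀∈Θ : InTheta T m₀
    m₀∈Θ = μ₀-lin ,
           singletons[]≔-Ornamentation (OrnamentAt-↾ (proj₁ ρ₂-orn t) t≤u) ,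
           singletons[]≔-Consecutive μ₀ (proj₁ μ₀-lin) (Consecutive-sorted S₀-≺-convex)
      where
      μ₀-lin : LinExt T μ₀
      μ₀-lin = LinExt-sorted λ x y x<y → key≤∧<⇒≺ (key-mono (proj₁ x<y)) (<T⇒< x<y)

    μ₀-weakLeq : ∀ μ {S} → LinExt T μ → Consecutive T μ S → S₀ ⊆ S → S ⊆ R₂ → WeakLeq T μ₀ μ
    μ₀-weakLeq μ (μ-perm , μ-ordered) S-cons S₀⊆S S⊆R₂ a b a<b b≺₀a
      with key-inversion a<b (≺∧>⇒key< (Precedes-sorted⁻ b≺₀a) a<b)
    ... | a-gap@(t≤a , a≤u , a∉R₂) , b∈S₀ with Precedes-connex μ μ-perm (λ a≡b → <-irrefl (cong toℕ a≡b) a<b)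
    ...   | inj₂ b≺a = b≺a
    ...   | inj₁ a≺b = ⊥-elim (a∉R₂ (S⊆R₂ (Consecutive-between μ μ-perm S-cons t≺a a≺b (S₀⊆S t∈S₀) (S₀⊆S b∈S₀))))
      where
      t≺a : Precedes T μ t a
      t≺a = μ-ordered t a (⊑-interval t⊑u t≤a a≤u , λ t≡a → a∉R₂ (S₀⊆R₂ (subst (_∈ S₀) t≡a t∈S₀)))

    m₀≤x₂ : _≤Θ_ T m₀ (λ₁ , ρ₂)
    m₀≤x₂ = μ₀-weakLeq λ₁ λ₁-lin (ρ₂-cons t) S₀⊆R₂ (λ x∈ → x∈) , singletons[]≔-≤ ρ₂ ρ₂-orn S₀⊆R₂

    m₀≰x₁ : ¬ _≤Θ_ T m₀ (λ₁ , ρ₁)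
    m₀≰x₁ (_ , σ₀≤ρ₁) = u∉R₁ (σ₀≤ρ₁ t (subst (u ∈_) (sym (lookup∘update t singletons S₀)) u∈S₀))

    module BelowX₂
      (μ : Vec (Fin n) n) (σ : Vec (Subset n) n)
      (μ-lin : LinExt T μ) (σ-orn : Ornamentation T σ) (σ-cons : ∀ v → Consecutive T μ (lookup σ v))
      (μ≤λ₁ : WeakLeq T μ λ₁) (σ≤ρ₂ : OrnLeq T σ ρ₂)
      where

      private
        μ-perm : IsPerm T μ
        μ-perm = proj₁ μ-lin

        σt-convex : ∀ {x y} → t ≢ x → t ⊑ x → Precedes T μ x y → y ∈ lookup σ t → x ∈ lookup σ t
        σt-convex t≢x t⊑x x≺y y∈σt =
          Consecutive-between μ μ-perm (σ-cons t) (proj₂ μ-lin t _ (t⊑x , t≢x)) x≺y (hook∈ σ σ-orn t) y∈σt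

      σt∩U⇒u∈σt : ∀ {x} → x ∈ lookup σ t → x ∈ U → u ∈ lookup σ t
      σt∩U⇒u∈σt {x} x∈σt x∈U with x Finₚ.≟ u
      ... | yes refl = x∈σt
      ... | no x≢u   = σt-convex t≢u t⊑u (proj₂ μ-lin u x (hook⊑ ρ₁ ρ₁-orn u x∈U , λ u≡x → x≢u (sym u≡x))) x∈σt

      u∉σt⇒σ≤ρ₁ : u ∉ lookup σ t → OrnLeq T σ ρ₁
      u∉σt⇒σ≤ρ₁ u∉σt v {x} x∈σv with v Finₚ.≟ t
      ... | no v≢t = subst (x ∈_) (sym (ρ-unchanged v v≢t)) (σ≤ρ₂ v x∈σv)
      ... | yes refl with x∈p∪q⁻ R₁ U (subst (x ∈_) ρ-merged (σ≤ρ₂ t x∈σv))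
      ...   | inj₁ x∈R₁ = x∈R₁
      ...   | inj₂ x∈U  = ⊥-elim (u∉σt (σt∩U⇒u∈σt x∈σv x∈U))

      S₀-precedes-u : ∀ {x} → x ∈ S₀ → x ≢ u → Precedes T μ x u
      S₀-precedes-u {x} x∈S₀ x≢u with Precedes-connex μ μ-perm x≢u
      ... | inj₁ x≺u = x≺u
      ... | inj₂ u≺x = ⊥-elim (Precedes-asym λ₁ λ₁-perm
                                (AfterBlock⇒Precedes λ₁ λ₁-perm u-after (S₀∖u⊆R₁ x∈S₀ x≢u))
                                (μ≤λ₁ x u x<u u≺x))
        where
        x<u : toℕ x < toℕ u
        x<u = ≤∧≢⇒< (S₀⇒≤u x∈S₀) (λ e → x≢u (Finₚ.toℕ-injective e))

      u∈σt⇒S₀⊆σt : u ∈ lookup σ t → S₀ ⊆ lookup σ t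
      u∈σt⇒S₀⊆σt u∈σt {x} x∈S₀ with x Finₚ.≟ u | t Finₚ.≟ x
      ... | yes refl | _        = u∈σt
      ... | no _     | yes refl = hook∈ σ σ-orn t
      ... | no x≢u   | no t≢x   = σt-convex t≢x (hook⊑ ρ₂ ρ₂-orn t (S₀⊆R₂ x∈S₀)) (S₀-precedes-u x∈S₀ x≢u) u∈σt

    Δ₂∖Δ₁ : Pair T → Set
    Δ₂∖Δ₁ z = InΔ T (λ₁ , ρ₂) z × ¬ InΔ T (λ₁ , ρ₁) z

    m₀-least : ∀ z → Δ₂∖Δ₁ z → _≤Θ_ T m₀ z
    m₀-least (μ , σ) ((z∈Θ@(μ-lin , σ-orn , σ-cons) , μ≤λ₁ , σ≤ρ₂) , z∉Δ₁) =
      μ₀-weakLeq μ μ-lin (σ-cons t) S₀⊆σt (σ≤ρ₂ t) , singletons[]≔-≤ σ σ-orn S₀⊆σt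
      where
      open BelowX₂ μ σ μ-lin σ-orn σ-cons μ≤λ₁ σ≤ρ₂
      S₀⊆σt : S₀ ⊆ lookup σ t
      S₀⊆σt with u ∈? lookup σ t
      ... | yes u∈σt = u∈σt⇒S₀⊆σt u∈σt
      ... | no u∉σt  = ⊥-elim (z∉Δ₁ (z∈Θ , μ≤λ₁ , u∉σt⇒σ≤ρ₁ u∉σt))

    Δ₂∖Δ₁-hasUniqueMinimal : HasUniqueMinimal T Δ₂∖Δ₁
    Δ₂∖Δ₁-hasUniqueMinimal =
      least⇒HasUniqueMinimal m₀ (λ _ z∈Δ → proj₁ (proj₁ z∈Δ))
        ((m₀∈Θ , m₀≤x₂) , λ m₀∈Δ₁ → m₀≰x₁ (proj₂ m₀∈Δ₁)) m₀-least

lemma5p3 : (T : PTree) (x₁ x₂ : Pair T) → InTheta T x₁ → InTheta T x₂ →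
    _⋖Θ_ T x₁ x₂ → AssocMove T x₁ x₂ →
    HasUniqueMinimal T (λ z → InΔ T x₂ z × ¬ InΔ T x₁ z)
lemma5p3 T (λ₁ , ρ₁) (.λ₁ , ρ₂) (λ₁-lin , ρ₁-orn , _) (_ , ρ₂-orn , ρ₂-cons) _
         (refl , t , u , u-after , ρ-unchanged , ρ-merged) =
  AssociahedronMove.Δ₂∖Δ₁-hasUniqueMinimal T λ₁ ρ₁ ρ₂ λ₁-lin ρ₁-orn ρ₂-orn ρ₂-cons
                                           t u u-after ρ-unchanged ρ-merged
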